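{- For every integer $m\ge 8$, $f(3^m, 4)\ge \left\lceil\frac{m+1}{4}\right\rceil$.
   Context: For a finite sequence of positive integers $(a_1,\dots,a_n)$, its continuant $\langle a_1,\dots,a_n\rangle$ is the denominator of the continued fraction $[0;a_1,\dots,a_n]$; equivalently $\langle\,\rangle=1$, $\langle a_1\rangle=a_1$, and $\langle a_1,\dots,a_n\rangle=a_n\langle a_1,\dots,a_{n-1}\rangle+\langle a_1,\dots,a_{n-2}\rangle$. For positive integers $D$ and $N$, $f(D,N)$ denotes the number of finite sequences $(a_1,\dots,a_n)$ of positive integers, of arbitrary length $n\ge 1$, with $a_i<N$ for all $i$ and $\langle a_1,\dots,a_n\rangle=D$. -}

module Defs where

open import Data.Nat using (ℕ; zero; suc; _+_; _*_; _∸_; _≟_)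
open import Data.List using (List; []; _∷_; _++_; length; filter; concatMap; map; upTo)

-- Continuant ⟨a₁,…,aₙ⟩ computed by the recurrence
--   ⟨⟩ = 1, ⟨a₁⟩ = a₁, ⟨a₁,…,aₖ⟩ = aₖ⟨a₁,…,aₖ₋₁⟩ + ⟨a₁,…,aₖ₋₂⟩,
-- scanning a₁, a₂, … in order; contAux cur prev rest carries
-- cur = ⟨a₁..aₖ⟩ and prev = ⟨a₁..aₖ₋₁⟩ (with the value 0 before ⟨⟩,
-- so that ⟨a₁⟩ = a₁·1 + 0 = a₁).
contAux : ℕ → ℕ → List ℕ → ℕ
contAux cur prev [] = cur
contAux cur prev (a ∷ as) = contAux (a * cur + prev) cur as

continuant : List ℕ → ℕ
continuant as = contAux 1 0 as

digits : ℕ → List ℕ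
digits N = map suc (upTo (N ∸ 1))

seqs : ℕ → ℕ → List (List ℕ)
seqs N zero = [] ∷ []
seqs N (suc n) = concatMap (λ a → map (a ∷_) (seqs N n)) (digits N)

seqsUpTo : ℕ → ℕ → List (List ℕ)
seqsUpTo N zero = []
seqsUpTo N (suc L) = seqsUpTo N L ++ seqs N (suc L)

-- A sequence of n positive integers has
-- continuant ≥ n (indeed ≥ Fₙ₊₁), so only lengths n ≤ D can contribute;
-- enumerating lengths 1..D therefore counts all such sequences.
f : ℕ → ℕ → ℕ
f D N = length (filter (λ as → continuant as ≟ D) (seqsUpTo N D))

ceil4 : ℕ → ℕ
ceil4 a = (a + 3) Data.Nat./ 4

module Submission where

-- We exhibit, for every m ≥ 4, at least (m+1)/4 distinct sequences over
-- {1,2,3} whose continuant is 3^m.  Every sequence has the framed shape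
-- 2,C,2.  The key fact is a palindrome identity: writing continuants as
-- products of the 2×2 matrices (a 1; 1 0), for a word w whose matrix has
-- quadratic form  k·(2s+t)²  one gets
--     ⟨2, C, w, reverse C, 2⟩ = k · ⟨2, C, 2⟩².
-- The words 31 and 13 realise k = 1, the words 2211 and 1122 realise k = 3,
-- so each framed sequence of continuant 3^j yields two framed sequences of
-- continuant 3^(2j) and two of continuant 3^(2j+1).  Starting from explicit
-- pairs of sequences for 3^4, …, 3^7 and halving m recursively, the number
-- of sequences at least doubles while m at most doubles, which keeps the
-- bound m + 1 ≤ 4·(count).

open import Defs
open import Data.Nat using (ℕ; _≤_; _^_; suc)
open import Data.Nat using (zero; _+_; _*_; _<_; s≤s; z≤n; z<s; ⌊_/2⌋)
open import Data.Nat.Properties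
open import Data.Nat.DivMod using (m<n*o⇒m/o<n)
open import Data.Nat.Induction using (<-rec)
open import Data.Nat.Tactic.RingSolver using (solve-∀)
open import Data.List using (List; []; _∷_; _++_; [_]; reverse; map; length; filter)
open import Data.List.Properties using (unfold-reverse; ++-assoc; length-++; length-map; length-reverse; ∷ʳ-injectiveˡ; ∷-injective)
open import Data.List.Relation.Unary.All using (All; []; _∷_)
import Data.List.Relation.Unary.All as All
import Data.List.Relation.Unary.All.Properties as AllP
import Data.List.Relation.Unary.Any as Any
open import Data.List.Relation.Unary.Any using (here; there)
open import Data.List.Relation.Unary.AllPairs using ([]; _∷_)
open import Data.List.Relation.Unary.Unique.Propositional using (Unique)
import Data.List.Relation.Unary.Unique.Propositional.Properties as UniqueP
open import Data.List.Membership.Propositional using (_∈_)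
open import Data.List.Membership.Propositional.Properties
  using (∈-map⁺; ∈-map⁻; ∈-++⁺ˡ; ∈-++⁺ʳ; ∈-++⁻; ∈-∃++; ∈-concatMap⁺; ∈-filter⁺)
open import Data.Sum using (inj₁; inj₂)
open import Data.Empty using (⊥)
open import Data.Product using (Σ; _×_; _,_; proj₁; proj₂)
open import Relation.Nullary using (¬_; yes; no; contradiction)
open import Relation.Binary.PropositionalEquality hiding ([_])

-- 2×2 matrices over ℕ and the matrix form of continuants

data Mat : Set where
  mk : ℕ → ℕ → ℕ → ℕ → Mat

infixr 7 _⊗_
_⊗_ : Mat → Mat → Mat
mk a b c d ⊗ mk e f g h = mk (a * e + b * g) (a * f + b * h) (c * e + d * g) (c * f + d * h)

I : Mat
I = mk 1 0 0 1

transpose : Mat → Mat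
transpose (mk a b c d) = mk a c b d

topLeft topRight bottomLeft : Mat → ℕ
topLeft (mk a _ _ _) = a
topRight (mk _ b _ _) = b
bottomLeft (mk _ _ c _) = c

digitMat : ℕ → Mat
digitMat x = mk x 1 1 0

matOf : List ℕ → Mat
matOf [] = I
matOf (x ∷ xs) = digitMat x ⊗ matOf xs

mk-cong : ∀ {a b c d a′ b′ c′ d′} → a ≡ a′ → b ≡ b′ → c ≡ c′ → d ≡ d′ →
          mk a b c d ≡ mk a′ b′ c′ d′
mk-cong refl refl refl refl = refl

⊗-identityˡ : ∀ M → I ⊗ M ≡ M
⊗-identityˡ (mk a b c d) = mk-cong (unit a c) (unit b d) (unit′ a c) (unit′ b d)
  where
  unit : ∀ x y → 1 * x + 0 * y ≡ x
  unit = solve-∀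
  unit′ : ∀ x y → 0 * x + 1 * y ≡ y
  unit′ = solve-∀

⊗-identityʳ : ∀ M → M ⊗ I ≡ M
⊗-identityʳ (mk a b c d) = mk-cong (unit a b) (unit′ a b) (unit c d) (unit′ c d)
  where
  unit : ∀ x y → x * 1 + y * 0 ≡ x
  unit = solve-∀
  unit′ : ∀ x y → x * 0 + y * 1 ≡ y
  unit′ = solve-∀

⊗-assoc : ∀ M N P → (M ⊗ N) ⊗ P ≡ M ⊗ (N ⊗ P)
⊗-assoc (mk a b c d) (mk e f g h) (mk i j k l) =
  mk-cong (entry a b e f g h i k) (entry a b e f g h j l) (entry c d e f g h i k) (entry c d e f g h j l)
  where
  entry : ∀ a b e f g h i k → (a * e + b * g) * i + (a * f + b * h) * k ≡ a * (e * i + f * k) + b * (g * i + h * k)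
  entry = solve-∀

transpose-⊗ : ∀ M N → transpose (M ⊗ N) ≡ transpose N ⊗ transpose M
transpose-⊗ (mk a b c d) (mk e f g h) =
  mk-cong (swap a e b g) (swap c e d g) (swap a f b h) (swap c f d h)
  where
  swap : ∀ x y z w → x * y + z * w ≡ y * x + w * z
  swap = solve-∀

matOf-++ : ∀ xs ys → matOf (xs ++ ys) ≡ matOf xs ⊗ matOf ys
matOf-++ [] ys = sym (⊗-identityˡ (matOf ys))
matOf-++ (x ∷ xs) ys = trans (cong (digitMat x ⊗_) (matOf-++ xs ys)) (sym (⊗-assoc (digitMat x) (matOf xs) (matOf ys)))

-- reversing a sequence transposes its matrix, since each digitMat is symmetric
matOf-reverse : ∀ xs → matOf (reverse xs) ≡ transpose (matOf xs)
matOf-reverse [] = refl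
matOf-reverse (x ∷ xs) = begin
  matOf (reverse (x ∷ xs))                 ≡⟨ cong matOf (unfold-reverse x xs) ⟩
  matOf (reverse xs ++ [ x ])              ≡⟨ matOf-++ (reverse xs) [ x ] ⟩
  matOf (reverse xs) ⊗ (digitMat x ⊗ I)    ≡⟨ cong₂ _⊗_ (matOf-reverse xs) (⊗-identityʳ (digitMat x)) ⟩
  transpose (matOf xs) ⊗ digitMat x        ≡⟨ sym (transpose-⊗ (digitMat x) (matOf xs)) ⟩
  transpose (matOf (x ∷ xs))               ∎
  where open ≡-Reasoning

contAux-matOf : ∀ cur prev as → contAux cur prev as ≡ cur * topLeft (matOf as) + prev * bottomLeft (matOf as)
contAux-matOf cur prev [] = unit cur prev
  where
  unit : ∀ c p → c ≡ c * 1 + p * 0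
  unit = solve-∀
contAux-matOf cur prev (x ∷ as) = trans (contAux-matOf (x * cur + prev) cur as) (step (matOf as))
  where
  shift : ∀ x c p A C → (x * c + p) * A + c * C ≡ c * (x * A + 1 * C) + p * (1 * A + 0 * C)
  shift = solve-∀
  step : ∀ M → (x * cur + prev) * topLeft M + cur * bottomLeft M
             ≡ cur * topLeft (digitMat x ⊗ M) + prev * bottomLeft (digitMat x ⊗ M)
  step (mk A B C D) = shift x cur prev A C

continuant-matOf : ∀ as → continuant as ≡ topLeft (matOf as)
continuant-matOf as = trans (contAux-matOf 1 0 as) (unit (topLeft (matOf as)) (bottomLeft (matOf as)))
  where
  unit : ∀ a c → 1 * a + 0 * c ≡ a
  unit = solve-∀

-- The palindrome identity

framed : List ℕ → List ℕ
framed C = 2 ∷ C ++ [ 2 ]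

mirror : List ℕ → List ℕ → List ℕ
mirror w C = C ++ w ++ reverse C

quadForm : Mat → ℕ → ℕ → ℕ
quadForm (mk a b c d) s t = s * (a * s + b * t) + t * (c * s + d * t)

record SquareForm (k : ℕ) (w : List ℕ) : Set where
  constructor squareForm
  field quadForm-square : ∀ s t → quadForm (matOf w) s t ≡ k * ((2 * s + t) * (2 * s + t))

matOf-palindrome : ∀ B w → matOf (B ++ w ++ reverse B) ≡ matOf B ⊗ matOf w ⊗ transpose (matOf B)
matOf-palindrome B w = trans (matOf-++ B (w ++ reverse B))
  (cong (matOf B ⊗_) (trans (matOf-++ w (reverse B)) (cong (matOf w ⊗_) (matOf-reverse B))))

sandwich : ∀ M N → topLeft (N ⊗ M ⊗ transpose N) ≡ quadForm M (topLeft N) (topRight N)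
sandwich (mk a b c d) (mk s t u v) = refl

continuant-framed : ∀ C → continuant (framed C) ≡ 2 * topLeft (matOf (2 ∷ C)) + topRight (matOf (2 ∷ C))
continuant-framed C = trans (continuant-matOf ((2 ∷ C) ++ [ 2 ]))
  (trans (cong topLeft (matOf-++ (2 ∷ C) [ 2 ])) (closeFrame (matOf (2 ∷ C))))
  where
  closeFrame : ∀ N → topLeft (N ⊗ matOf [ 2 ]) ≡ 2 * topLeft N + topRight N
  closeFrame (mk s t u v) = identity s t
    where
    identity : ∀ s t → s * 2 + t * 1 ≡ 2 * s + t
    identity = solve-∀

framed-mirror : ∀ w C → framed (mirror w C) ≡ (2 ∷ C) ++ w ++ reverse (2 ∷ C)
framed-mirror w C = cong (2 ∷_) (begin
  (C ++ w ++ reverse C) ++ [ 2 ]  ≡⟨ ++-assoc C (w ++ reverse C) [ 2 ] ⟩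
  C ++ (w ++ reverse C) ++ [ 2 ]  ≡⟨ cong (C ++_) (++-assoc w (reverse C) [ 2 ]) ⟩
  C ++ w ++ reverse C ++ [ 2 ]    ≡⟨ cong (λ z → C ++ w ++ z) (sym (unfold-reverse 2 C)) ⟩
  C ++ w ++ reverse (2 ∷ C)       ∎)
  where open ≡-Reasoning

continuant-framed-mirror : ∀ {k w} → SquareForm k w → ∀ C →
  continuant (framed (mirror w C)) ≡ k * (continuant (framed C) * continuant (framed C))
continuant-framed-mirror {k} {w} (squareForm square) C = begin
  continuant (framed (mirror w C))           ≡⟨ cong continuant (framed-mirror w C) ⟩
  continuant (B ++ w ++ reverse B)           ≡⟨ continuant-matOf (B ++ w ++ reverse B) ⟩
  topLeft (matOf (B ++ w ++ reverse B))      ≡⟨ cong topLeft (matOf-palindrome B w) ⟩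
  topLeft (N ⊗ matOf w ⊗ transpose N)        ≡⟨ sandwich (matOf w) N ⟩
  quadForm (matOf w) s t                     ≡⟨ square s t ⟩
  k * ((2 * s + t) * (2 * s + t))            ≡⟨ cong (λ z → k * (z * z)) (sym (continuant-framed C)) ⟩
  k * (continuant (framed C) * continuant (framed C)) ∎
  where
  open ≡-Reasoning
  B = 2 ∷ C
  N = matOf B
  s = topLeft N
  t = topRight N

-- the four middle words; matOf (3,1) = (4 3; 1 1), matOf (1,3) = (4 1; 3 1),
-- matOf (2,2,1,1) = (12 7; 5 3), matOf (1,1,2,2) = (12 5; 7 3)
squareForm-31 : SquareForm 1 (3 ∷ 1 ∷ [])
squareForm-31 = squareForm identity
  where
  identity : ∀ s t → s * (4 * s + 3 * t) + t * (1 * s + 1 * t) ≡ 1 * ((2 * s + t) * (2 * s + t))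
  identity = solve-∀

squareForm-13 : SquareForm 1 (1 ∷ 3 ∷ [])
squareForm-13 = squareForm identity
  where
  identity : ∀ s t → s * (4 * s + 1 * t) + t * (3 * s + 1 * t) ≡ 1 * ((2 * s + t) * (2 * s + t))
  identity = solve-∀

squareForm-2211 : SquareForm 3 (2 ∷ 2 ∷ 1 ∷ 1 ∷ [])
squareForm-2211 = squareForm identity
  where
  identity : ∀ s t → s * (12 * s + 7 * t) + t * (5 * s + 3 * t) ≡ 3 * ((2 * s + t) * (2 * s + t))
  identity = solve-∀

squareForm-1122 : SquareForm 3 (1 ∷ 1 ∷ 2 ∷ 2 ∷ [])
squareForm-1122 = squareForm identity
  where
  identity : ∀ s t → s * (12 * s + 5 * t) + t * (7 * s + 3 * t) ≡ 3 * ((2 * s + t) * (2 * s + t))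
  identity = solve-∀

-- Injectivity of the mirror construction

++-cancel-length : ∀ {A : Set} (xs xs′ ys ys′ : List A) → length xs ≡ length xs′ →
                   xs ++ ys ≡ xs′ ++ ys′ → xs ≡ xs′ × ys ≡ ys′
++-cancel-length [] [] ys ys′ _ e = refl , e
++-cancel-length (x ∷ xs) (x′ ∷ xs′) ys ys′ l e with ∷-injective e
... | refl , e′ with ++-cancel-length xs xs′ ys ys′ (suc-injective l) e′
...   | refl , r = refl , r

double-injective : ∀ m n → m + m ≡ n + n → m ≡ n
double-injective m n e = trans (n≡⌊n+n/2⌋ m) (trans (cong ⌊_/2⌋ e) (sym (n≡⌊n+n/2⌋ n)))

length-mirror : ∀ w C → length (mirror w C) ≡ length w + (length C + length C)
length-mirror w C = begin
  length (C ++ w ++ reverse C)                ≡⟨ length-++ C ⟩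
  length C + length (w ++ reverse C)          ≡⟨ cong (length C +_) (length-++ w) ⟩
  length C + (length w + length (reverse C))  ≡⟨ cong (λ z → length C + (length w + z)) (length-reverse C) ⟩
  length C + (length w + length C)            ≡⟨ +-comm (length C) _ ⟩
  (length w + length C) + length C            ≡⟨ +-assoc (length w) _ _ ⟩
  length w + (length C + length C)            ∎
  where open ≡-Reasoning

mirror-injective : ∀ w w′ C C′ → length w ≡ length w′ → mirror w C ≡ mirror w′ C′ → C ≡ C′ × w ≡ w′
mirror-injective w w′ C C′ lw e
  with ++-cancel-length C C′ (w ++ reverse C) (w′ ++ reverse C′) sameOuter e
  where
  sameOuter : length C ≡ length C′
  sameOuter = double-injective _ _ (+-cancelˡ-≡ (length w) _ _
    (trans (sym (length-mirror w C)) (trans (cong length e)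
      (trans (length-mirror w′ C′) (cong (_+ (length C′ + length C′)) (sym lw))))))
... | refl , e′ with ++-cancel-length w w′ (reverse C) (reverse C) lw e′
...   | refl , _ = refl , refl

-- Framed sequences over {1,2,3} and families of them

Digit : ℕ → Set
Digit a = a ∈ digits 4

Framed : ℕ → List ℕ → Set
Framed D C = All Digit C × continuant (framed C) ≡ D

All-reverse : ∀ {P : ℕ → Set} xs → All P xs → All P (reverse xs)
All-reverse [] [] = []
All-reverse {P} (x ∷ xs) (p ∷ ps) = subst (All P) (sym (unfold-reverse x xs)) (AllP.∷ʳ⁺ (All-reverse xs ps) p)

mirror-framed : ∀ {k w D D′ C} → SquareForm k w → All Digit w → k * (D * D) ≡ D′ →
                Framed D C → Framed D′ (mirror w C)
mirror-framed {k} {C = C} square dw value (dc , e) =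
  AllP.++⁺ dc (AllP.++⁺ dw (All-reverse C dc)) ,
  trans (continuant-framed-mirror square C) (trans (cong (λ z → k * (z * z)) e) value)

record Twins (k : ℕ) : Set where
  field
    left right        : List ℕ
    left-digits       : All Digit left
    right-digits      : All Digit right
    left-square       : SquareForm k left
    right-square      : SquareForm k right
    same-length       : length left ≡ length right
    different         : ¬ left ≡ right

d1 : Digit 1
d1 = here refl
d2 : Digit 2
d2 = there (here refl)
d3 : Digit 3
d3 = there (there (here refl))

twins-1 : Twins 1
twins-1 = record
  { left = 3 ∷ 1 ∷ [] ; right = 1 ∷ 3 ∷ []
  ; left-digits = d3 ∷ d1 ∷ [] ; right-digits = d1 ∷ d3 ∷ []
  ; left-square = squareForm-31 ; right-square = squareForm-13
  ; same-length = refl ; different = λ () }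

twins-3 : Twins 3
twins-3 = record
  { left = 2 ∷ 2 ∷ 1 ∷ 1 ∷ [] ; right = 1 ∷ 1 ∷ 2 ∷ 2 ∷ []
  ; left-digits = d2 ∷ d2 ∷ d1 ∷ d1 ∷ [] ; right-digits = d1 ∷ d1 ∷ d2 ∷ d2 ∷ []
  ; left-square = squareForm-2211 ; right-square = squareForm-1122
  ; same-length = refl ; different = λ () }

record Family (D : ℕ) : Set where
  field
    members    : List (List ℕ)
    unique     : Unique members
    admissible : All (Framed D) members

open Family

double : ∀ {k D D′} → Twins k → k * (D * D) ≡ D′ → Family D → Family D′
double tw value F = record
  { members = map (mirror left) L ++ map (mirror right) L
  ; unique = UniqueP.++⁺ (UniqueP.map⁺ (outer-injective left) (unique F))
                         (UniqueP.map⁺ (outer-injective right) (unique F)) disjoint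
  ; admissible = AllP.++⁺ (AllP.map⁺ (All.map (mirror-framed left-square left-digits value) (admissible F)))
                          (AllP.map⁺ (All.map (mirror-framed right-square right-digits value) (admissible F))) }
  where
  open Twins tw
  L = members F
  outer-injective : ∀ w {C C′} → mirror w C ≡ mirror w C′ → C ≡ C′
  outer-injective w e = proj₁ (mirror-injective w w _ _ refl e)
  disjoint : ∀ {v} → v ∈ map (mirror left) L × v ∈ map (mirror right) L → ⊥
  disjoint (p , p′) with ∈-map⁻ (mirror left) p | ∈-map⁻ (mirror right) p′
  ... | C , _ , refl | C′ , _ , e = different (proj₂ (mirror-injective left right C C′ same-length e))

-- Families for powers of three, large enough for the theorem

Large : ℕ → Set
Large m = Σ (Family (3 ^ m)) λ F → suc m ≤ 4 * length (members F)

length-map-++-map : ∀ (g h : List ℕ → List ℕ) L → length (map g L ++ map h L) ≡ length L + length L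
length-map-++-map g h L = trans (length-++ (map g L)) (cong₂ _+_ (length-map g L) (length-map h L))

large-step : ∀ {k j m} → Twins k → k * (3 ^ j * 3 ^ j) ≡ 3 ^ m → m ≤ suc (j + j) → Large j → Large m
large-step {j = j} {m} tw value m≤ (F , bound) = double tw value F , (begin
  suc m                  ≤⟨ s≤s m≤ ⟩
  suc (suc (j + j))      ≡⟨ cong suc (sym (+-suc j j)) ⟩
  suc j + suc j          ≤⟨ +-mono-≤ bound bound ⟩
  4 * n + 4 * n          ≡⟨ sym (*-distribˡ-+ 4 n n) ⟩
  4 * (n + n)            ≡⟨ cong (4 *_) (sym (length-map-++-map (mirror left) (mirror right) (members F))) ⟩
  4 * length (members (double tw value F)) ∎)
  where
  open ≤-Reasoning
  open Twins tw
  n = length (members F)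

large-even : ∀ j → Large j → Large (j + j)
large-even j = large-step twins-1 (trans (*-identityˡ _) (sym (^-distribˡ-+-* 3 j j))) (n≤1+n _)

large-odd : ∀ j → Large j → Large (suc (j + j))
large-odd j = large-step twins-3 (cong (3 *_) (sym (^-distribˡ-+-* 3 j j))) ≤-refl

large-pair : ∀ {m} C C′ → ¬ C ≡ C′ → Framed (3 ^ m) C → Framed (3 ^ m) C′ → m < 8 → Large m
large-pair C C′ C≢C′ fC fC′ m<8 =
  record { members = C ∷ C′ ∷ [] ; unique = (C≢C′ ∷ []) ∷ [] ∷ [] ; admissible = fC ∷ fC′ ∷ [] } , m<8

large-4 : Large 4
large-4 = large-pair (1 ∷ 1 ∷ 1 ∷ 1 ∷ 2 ∷ []) (2 ∷ 1 ∷ 1 ∷ 1 ∷ 1 ∷ []) (λ ())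
  ((d1 ∷ d1 ∷ d1 ∷ d1 ∷ d2 ∷ []) , refl) ((d2 ∷ d1 ∷ d1 ∷ d1 ∷ d1 ∷ []) , refl) (m≤m+n 5 3)

large-5 : Large 5
large-5 = large-pair (1 ∷ 1 ∷ 2 ∷ 2 ∷ 3 ∷ []) (2 ∷ 1 ∷ 3 ∷ 1 ∷ 1 ∷ 1 ∷ []) (λ ())
  ((d1 ∷ d1 ∷ d2 ∷ d2 ∷ d3 ∷ []) , refl) ((d2 ∷ d1 ∷ d3 ∷ d1 ∷ d1 ∷ d1 ∷ []) , refl) (m≤m+n 6 2)

large-6 : Large 6
large-6 = large-pair (3 ∷ 1 ∷ 3 ∷ 1 ∷ 2 ∷ 1 ∷ 1 ∷ []) (1 ∷ 1 ∷ 2 ∷ 1 ∷ 3 ∷ 1 ∷ 3 ∷ []) (λ ())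
  ((d3 ∷ d1 ∷ d3 ∷ d1 ∷ d2 ∷ d1 ∷ d1 ∷ []) , refl) ((d1 ∷ d1 ∷ d2 ∷ d1 ∷ d3 ∷ d1 ∷ d3 ∷ []) , refl) (m≤m+n 7 1)

large-7 : Large 7
large-7 = large-pair (1 ∷ 1 ∷ 3 ∷ 2 ∷ 2 ∷ 2 ∷ 1 ∷ 2 ∷ []) (2 ∷ 1 ∷ 2 ∷ 2 ∷ 2 ∷ 3 ∷ 1 ∷ 1 ∷ []) (λ ())
  ((d1 ∷ d1 ∷ d3 ∷ d2 ∷ d2 ∷ d2 ∷ d1 ∷ d2 ∷ []) , refl) ((d2 ∷ d1 ∷ d2 ∷ d2 ∷ d2 ∷ d3 ∷ d1 ∷ d1 ∷ []) , refl) ≤-refl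

data Halving : ℕ → Set where
  even : ∀ j → Halving (j + j)
  odd  : ∀ j → Halving (suc (j + j))

halving : ∀ m → Halving m
halving zero = even 0
halving (suc m) with halving m
... | even j = odd j
... | odd j = subst Halving (cong suc (+-suc j j)) (even (suc j))

large : ∀ m → 4 ≤ m → Large m
large = <-rec (λ m → 4 ≤ m → Large m) step
  where
  step : ∀ m → (∀ {j} → j < m → 4 ≤ j → Large j) → 4 ≤ m → Large m
  step m rec 4≤m with halving m
  step .(0 + 0) rec () | even 0
  step .(1 + 1) rec (s≤s (s≤s ())) | even 1
  step .(2 + 2) rec _ | even 2 = large-4
  step .(3 + 3) rec _ | even 3 = large-6
  step .(j + j) rec _ | even j@(suc (suc (suc (suc _)))) =
    large-even j (rec (m<m+n j z<s) (s≤s (s≤s (s≤s (s≤s z≤n)))))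
  step .(suc (0 + 0)) rec (s≤s ()) | odd 0
  step .(suc (1 + 1)) rec (s≤s (s≤s (s≤s ()))) | odd 1
  step .(suc (2 + 2)) rec _ | odd 2 = large-5
  step .(suc (3 + 3)) rec _ | odd 3 = large-7
  step .(suc (j + j)) rec _ | odd j@(suc (suc (suc (suc _)))) =
    large-odd j (rec (s≤s (m≤m+n j j)) (s≤s (s≤s (s≤s (s≤s z≤n)))))

-- Counting: distinct admissible sequences inject into the list counted by f

digits-positive : ∀ {N a} → a ∈ digits N → 1 ≤ a
digits-positive p with ∈-map⁻ suc p
... | _ , _ , refl = s≤s z≤n

contAux-≥ : ∀ cur prev as → All (1 ≤_) as → 1 ≤ prev → prev ≤ cur → length as + cur ≤ contAux cur prev as
contAux-≥ cur prev [] [] _ _ = ≤-refl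
contAux-≥ cur prev (a ∷ as) (1≤a ∷ ps) 1≤prev prev≤cur = begin
  suc (length as + cur)  ≡⟨ sym (+-suc (length as) cur) ⟩
  length as + suc cur    ≡⟨ cong (length as +_) (+-comm 1 cur) ⟩
  length as + (cur + 1)  ≤⟨ +-monoʳ-≤ (length as) (+-mono-≤ cur≤a*cur 1≤prev) ⟩
  length as + next       ≤⟨ contAux-≥ next cur as ps (≤-trans 1≤prev prev≤cur) (≤-trans cur≤a*cur (m≤m+n (a * cur) prev)) ⟩
  contAux next cur as    ∎
  where
  open ≤-Reasoning
  next = a * cur + prev
  cur≤a*cur : cur ≤ a * cur
  cur≤a*cur = subst (_≤ a * cur) (*-identityˡ cur) (*-monoˡ-≤ cur 1≤a)

continuant-≥-length : ∀ as → All (1 ≤_) as → length as ≤ continuant as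
continuant-≥-length [] [] = z≤n
continuant-≥-length (a ∷ as) (1≤a ∷ ps) = begin
  suc (length as)        ≡⟨ +-comm 1 (length as) ⟩
  length as + 1          ≤⟨ +-monoʳ-≤ (length as) 1≤a′ ⟩
  length as + a′         ≤⟨ contAux-≥ a′ 1 as ps ≤-refl 1≤a′ ⟩
  contAux a′ 1 as        ∎
  where
  open ≤-Reasoning
  a′ = a * 1 + 0
  1≤a′ : 1 ≤ a′
  1≤a′ = subst (1 ≤_) (sym (trans (+-identityʳ _) (*-identityʳ a))) 1≤a

seqs-complete : ∀ N xs → All (_∈ digits N) xs → xs ∈ seqs N (length xs)
seqs-complete N [] [] = here refl
seqs-complete N (x ∷ xs) (d ∷ ds) = ∈-concatMap⁺ (λ a → map (a ∷_) (seqs N (length xs)))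
  (Any.map (λ { refl → ∈-map⁺ (x ∷_) (seqs-complete N xs ds) }) d)

seqsUpTo-complete : ∀ N L xs → 1 ≤ length xs → length xs ≤ L → All (_∈ digits N) xs → xs ∈ seqsUpTo N L
seqsUpTo-complete N zero xs 1≤l l≤0 ds = contradiction (≤-trans 1≤l l≤0) λ ()
seqsUpTo-complete N (suc L) xs 1≤l l≤L+1 ds with length xs ≤? L
... | yes l≤L = ∈-++⁺ˡ (seqsUpTo-complete N L xs 1≤l l≤L ds)
... | no l≰L = ∈-++⁺ʳ (seqsUpTo N L)
  (subst (λ n → xs ∈ seqs N n) (≤-antisym l≤L+1 (≰⇒> l≰L)) (seqs-complete N xs ds))

unique-length-≤ : ∀ {A : Set} (xs ys : List A) → Unique xs → All (_∈ ys) xs → length xs ≤ length ys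
unique-length-≤ [] ys _ _ = z≤n
unique-length-≤ (x ∷ xs) ys (x∉xs ∷ u) (x∈ys ∷ xs⊆ys) with ∈-∃++ x∈ys
... | ys₁ , ys₂ , refl = begin
  suc (length xs)                     ≤⟨ s≤s (unique-length-≤ xs (ys₁ ++ ys₂) u (All.zipWith remove (x∉xs , xs⊆ys))) ⟩
  suc (length (ys₁ ++ ys₂))           ≡⟨ cong suc (length-++ ys₁) ⟩
  suc (length ys₁ + length ys₂)       ≡⟨ sym (+-suc (length ys₁) (length ys₂)) ⟩
  length ys₁ + length (x ∷ ys₂)       ≡⟨ sym (length-++ ys₁) ⟩
  length (ys₁ ++ x ∷ ys₂)             ∎
  where
  open ≤-Reasoning
  remove : ∀ {z} → ¬ x ≡ z × z ∈ ys₁ ++ x ∷ ys₂ → z ∈ ys₁ ++ ys₂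
  remove (x≢z , z∈) with ∈-++⁻ ys₁ z∈
  ... | inj₁ p = ∈-++⁺ˡ p
  ... | inj₂ (here refl) = contradiction refl x≢z
  ... | inj₂ (there p) = ∈-++⁺ʳ ys₁ p

Counted : ℕ → ℕ → List ℕ → Set
Counted D N xs = 1 ≤ length xs × All (_∈ digits N) xs × continuant xs ≡ D

f-lower-bound : ∀ D N (L : List (List ℕ)) → Unique L → All (Counted D N) L → length L ≤ f D N
f-lower-bound D N L u counted = unique-length-≤ L _ u (All.map listed counted)
  where
  listed : ∀ {xs} → Counted D N xs → xs ∈ filter (λ as → continuant as ≟ D) (seqsUpTo N D)
  listed {xs} (1≤l , ds , e) = ∈-filter⁺ (λ as → continuant as ≟ D)
    (seqsUpTo-complete N D xs 1≤l (subst (length xs ≤_) e (continuant-≥-length xs (All.map (digits-positive {N}) ds))) ds) e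

framed-injective : ∀ {C C′} → framed C ≡ framed C′ → C ≡ C′
framed-injective {C} {C′} e = ∷ʳ-injectiveˡ C C′ (proj₂ (∷-injective e))

ceil4-bound : ∀ m n → suc m ≤ 4 * n → ceil4 (suc m) ≤ n
ceil4-bound m n b = ≤-pred (m<n*o⇒m/o<n {suc m + 3} {suc n} {4} lt)
  where
  lt : suc m + 3 < suc n * 4
  lt = subst₂ _≤_ (+-suc (suc m) 3) (trans (+-comm (4 * n) 4) (cong (4 +_) (*-comm 4 n))) (+-mono-≤ b (≤-refl {4}))

theorem4 : (m : ℕ) → 8 ≤ m → ceil4 (suc m) ≤ f (3 ^ m) 4
theorem4 m 8≤m with large m (≤-trans (m≤m+n 4 4) 8≤m)
... | F , bound = begin
  ceil4 (suc m)                 ≤⟨ ceil4-bound m (length L) bound ⟩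
  length L                      ≡⟨ sym (length-map framed L) ⟩
  length (map framed L)         ≤⟨ f-lower-bound (3 ^ m) 4 (map framed L)
                                     (UniqueP.map⁺ framed-injective (unique F))
                                     (AllP.map⁺ (All.map counted (admissible F))) ⟩
  f (3 ^ m) 4                   ∎
  where
  open ≤-Reasoning
  L = members F
  counted : ∀ {C} → Framed (3 ^ m) C → Counted (3 ^ m) 4 (framed C)
  counted (dc , e) = s≤s z≤n , d2 ∷ AllP.++⁺ dc (d2 ∷ []) , e
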